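{- Let the vocabulary of directed graphs (one binary edge relation) be extended by infinitely many new relation symbols $R_i^j$ ($i,j\ge1$), with infinitely many new relation symbols of each arity. There exists a set $\mathcal{D}=\{D_1,D_2,\ldots\}$ of finite directed graphs which also interpret all the new relation symbols, such that $\mathcal{D}$ admits fixed points of unbounded depth, and yet every $(\mathrm{FO}+\mathrm{LFP})$ formula in this expanded language is equivalent on $\mathcal{D}$ to a first-order formula.
   Context: Each formula uses only finitely many symbols. A formula $\psi$ is equivalent on a class $K$ to a formula $\chi$ if for every $M\in K$ and every tuple $\bar a$, $M\models\psi(\bar a)\iff M\models\chi(\bar a)$. Positive elementary induction: given a first-order formula $\phi(P,v_1,\ldots,v_s)$ in which the $r$-ary predicate $P$ occurs only positively, a structure $M$ and parameters $a_{r+1},\ldots,a_s$, set $P_0=\emptyset$, $P_{i+1}=\{(v_1,\ldots,v_r)\mid M\models\phi(P_i,v_1,\ldots,v_r,a_{r+1},\ldots,a_s)\}$. A class $K$ admits fixed points of unbounded depth if for some such $\phi$ there is no $j$ with $P_j=\bigcup_iP_i$ for all $M\in K$ and all parameters. $(\mathrm{FO}+\mathrm{LFP})$ is first-order logic extended with the least-fixed-point operator $\mathrm{LFP}_{P;v_1,\ldots,v_r}\phi$, true at $(a_1,\ldots,a_s)$ iff $(a_1,\ldots,a_r)\in\bigcup_iP_i$, usable with nesting. -}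

module Defs where

open import Data.Nat using (ℕ; zero; suc; _≟_)
open import Data.Fin using (Fin)
open import Data.Vec using (Vec; []; _∷_; map; lookup)
open import Data.Bool using (Bool; T)
open import Data.Product using (Σ; _×_; _,_)
open import Data.Unit using (⊤)
open import Data.Empty using (⊥)
open import Data.List using (List; []; _∷_)
open import Data.List.Membership.Propositional using (_∈_)
open import Relation.Nullary using (¬_; yes; no)
open import Relation.Binary.PropositionalEquality using (_≡_; refl)
open import Function.Bundles using (_⇔_)

-- Vocabulary: the edge relation E (binary) and symbols R i j,
-- where R i j stands for R_{i+1}^{j+1}, the (i+1)-th new symbol of
-- arity j+1.  So there are infinitely many new symbols of each arity ≥ 1.

data Sym : Set where
  E : Sym
  R : (i j : ℕ) → Sym

arity : Sym → ℕ
arity E       = 2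
arity (R i j) = suc j

record Structure : Set where
  field
    size   : ℕ
    interp : (s : Sym) → Vec (Fin size) (arity s) → Bool
open Structure public

-- Syntax of (FO+LFP).  First-order variables are named by ℕ;
-- relation variables are named by a pair (name, arity).

data Formula : Set where
  rel  : (s : Sym) → Vec ℕ (arity s) → Formula
  eq   : ℕ → ℕ → Formula
  rv   : (X : ℕ) {k : ℕ} → Vec ℕ k → Formula
  neg  : Formula → Formula
  and  : Formula → Formula → Formula
  ex   : ℕ → Formula → Formula
  lfp  : (P : ℕ) {r : ℕ} → Vec ℕ r → Formula → Vec ℕ r → Formula

Assign : ℕ → Set
Assign n = ℕ → Fin n

REnv : ℕ → Set₁
REnv n = (X : ℕ) (k : ℕ) → Vec (Fin n) k → Set

emptyEnv : ∀ {n} → REnv n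
emptyEnv X k a = ⊥

_[_↦_] : ∀ {n} → Assign n → ℕ → Fin n → Assign n
(ρ [ x ↦ a ]) y with y ≟ x
... | yes _ = a
... | no  _ = ρ y

updates : ∀ {n r} → Assign n → Vec ℕ r → Vec (Fin n) r → Assign n
updates ρ []       []       = ρ
updates ρ (v ∷ vs) (a ∷ as) = updates (ρ [ v ↦ a ]) vs as

updRel : ∀ {n} → REnv n → (P r : ℕ) → (Vec (Fin n) r → Set) → REnv n
updRel η P r S X k with X ≟ P | k ≟ r
... | yes refl | yes refl = S
... | _        | _        = η X k

mutual
  ⟦_⟧ : Formula → (M : Structure) → REnv (size M) → Assign (size M) → Set
  ⟦ rel s ts ⟧ M η ρ = T (interp M s (map ρ ts))
  ⟦ eq x y ⟧ M η ρ = ρ x ≡ ρ y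
  ⟦ rv X {k} ts ⟧ M η ρ = η X k (map ρ ts)
  ⟦ neg φ ⟧ M η ρ = ¬ ⟦ φ ⟧ M η ρ
  ⟦ and φ ψ ⟧ M η ρ = ⟦ φ ⟧ M η ρ × ⟦ ψ ⟧ M η ρ
  ⟦ ex x φ ⟧ M η ρ = Σ (Fin (size M)) λ a → ⟦ φ ⟧ M η (ρ [ x ↦ a ])
  ⟦ lfp P vs φ ts ⟧ M η ρ = Σ ℕ λ i → stage P vs φ M η ρ i (map ρ ts)

  stage : (P : ℕ) {r : ℕ} → Vec ℕ r → Formula → (M : Structure) →
          REnv (size M) → Assign (size M) → ℕ → Vec (Fin (size M)) r → Set
  stage P vs φ M η ρ zero    a = ⊥
  stage P {r} vs φ M η ρ (suc i) a =
    ⟦ φ ⟧ M (updRel η P r (stage P vs φ M η ρ i)) (updates ρ vs a)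

Distinct : ∀ {r} → Vec ℕ r → Set
Distinct {r} vs = ∀ (p q : Fin r) → lookup vs p ≡ lookup vs q → p ≡ q

mutual
  Pos : ℕ → ℕ → Formula → Set
  Pos P r (rel s ts) = ⊤
  Pos P r (eq x y) = ⊤
  Pos P r (rv X ts) = ⊤
  Pos P r (neg φ) = Neg P r φ
  Pos P r (and φ ψ) = Pos P r φ × Pos P r ψ
  Pos P r (ex x φ) = Pos P r φ
  Pos P r (lfp Q {k} vs φ ts) with Q ≟ P | k ≟ r
  ... | yes _ | yes _ = ⊤            -- P is rebound here
  ... | _     | _     = Pos P r φ

  Neg : ℕ → ℕ → Formula → Set
  Neg P r (rel s ts) = ⊤
  Neg P r (eq x y) = ⊤
  Neg P r (rv X {k} ts) = ¬ (X ≡ P × k ≡ r)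
  Neg P r (neg φ) = Pos P r φ
  Neg P r (and φ ψ) = Neg P r φ × Neg P r ψ
  Neg P r (ex x φ) = Neg P r φ
  Neg P r (lfp Q {k} vs φ ts) with Q ≟ P | k ≟ r
  ... | yes _ | yes _ = ⊤
  ... | _     | _     = Neg P r φ

WF : Formula → Set
WF (rel s ts) = ⊤
WF (eq x y) = ⊤
WF (rv X ts) = ⊤
WF (neg φ) = WF φ
WF (and φ ψ) = WF φ × WF ψ
WF (ex x φ) = WF φ
WF (lfp P {r} vs φ ts) = Distinct vs × Pos P r φ × WF φ

RVClosed : List (ℕ × ℕ) → Formula → Set
RVClosed L (rel s ts) = ⊤
RVClosed L (eq x y) = ⊤
RVClosed L (rv X {k} ts) = (X , k) ∈ L
RVClosed L (neg φ) = RVClosed L φ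
RVClosed L (and φ ψ) = RVClosed L φ × RVClosed L ψ
RVClosed L (ex x φ) = RVClosed L φ
RVClosed L (lfp P {r} vs φ ts) = RVClosed ((P , r) ∷ L) φ

NoLFP : Formula → Set
NoLFP (rel s ts) = ⊤
NoLFP (eq x y) = ⊤
NoLFP (rv X ts) = ⊤
NoLFP (neg φ) = NoLFP φ
NoLFP (and φ ψ) = NoLFP φ × NoLFP ψ
NoLFP (ex x φ) = NoLFP φ
NoLFP (lfp P vs φ ts) = ⊥

IsFOLFP : Formula → Set
IsFOLFP φ = WF φ × RVClosed [] φ

IsFO : Formula → Set
IsFO φ = NoLFP φ × RVClosed [] φ

IsFOwith : ℕ → ℕ → Formula → Set
IsFOwith P r φ = NoLFP φ × RVClosed ((P , r) ∷ []) φ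

UnboundedDepth : (ℕ → Structure) → Set
UnboundedDepth D =
  Σ ℕ λ P → Σ ℕ λ r → Σ (Vec ℕ r) λ vs → Σ Formula λ φ →
    (IsFOwith P r φ × Pos P r φ × Distinct vs) ×
    ¬ (Σ ℕ λ j → ∀ (m : ℕ) (ρ : Assign (size (D m))) (a : Vec (Fin (size (D m))) r) →
          (stage P vs φ (D m) emptyEnv ρ j a
            ⇔ Σ ℕ λ i → stage P vs φ (D m) emptyEnv ρ i a))

EquivOn : (ℕ → Structure) → Formula → Formula → Set
EquivOn D ψ χ = ∀ (m : ℕ) (ρ : Assign (size (D m))) →
  ⟦ ψ ⟧ (D m) emptyEnv ρ ⇔ ⟦ χ ⟧ (D m) emptyEnv ρ

-- On a finite structure every (FO+LFP) formula is decidable: the stages of an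
-- induction form a sequence of relations on a finite set in which each stage
-- determines the next, so by pigeonhole the sequence is eventually periodic and
-- its union is reached after boundedly many stages.
-- This lets the structures interpret the new symbols by formulas: on the path
-- 0 → 1 → ⋯ → m, the symbol R c J holds of a₀ … a_J iff the formula with Gödel
-- number c holds under xᵢ ↦ aᵢ, which is well defined by induction on J once
-- that formula is evaluated with the symbols R _ j, j < J, already interpreted.
-- Every formula ψ whose variables and symbol indices lie below J is then
-- equivalent to the atom R ⌜ψ⌝ J (x₀, …, x_J).  Fixed points still have
-- unbounded depth: transitive closure on a path needs as many stages as the
-- path is long.

module Submission where

open import Defs
open import Data.Bool using (Bool; false; T)
open import Data.Empty using (⊥-elim)
open import Data.Fin using (Fin; zero; suc; toℕ; fromℕ; fromℕ<; funToFin; finToFun)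
open import Data.Fin.Properties using (any?; pigeonhole; toℕ<n; finToFun-funToFin; toℕ-fromℕ<; toℕ-fromℕ)
  renaming (_≟_ to _≟ᶠ_)
open import Data.Nat using (ℕ; zero; suc; _+_; _^_; _⊔_; _≤_; _<_; z≤n; s≤s; _≟_; _≤?_; _<?_)
open import Data.Nat.Properties
  using ( ≤-refl; ≤-<-trans; <-trans; m<n⇒m<1+n; 1+n≰n; ≤∧≢⇒<; m⊔n≤o⇒m≤o; m⊔n≤o⇒n≤o; m≤m+n
        ; +-suc; +-comm; module ≤-Reasoning)
open import Data.List using (List; []; _∷_; _++_)
open import Data.List.Properties using (++-assoc; ++-identityʳ)
open import Data.List.Relation.Unary.Any using (here)
open import Data.Maybe as Maybe using (Maybe; just; nothing; maybe; _>>=_)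
open import Data.Nat.Binary as ℕᵇ using (ℕᵇ; 2[1+_]; 1+[2_])
open import Data.Nat.Binary.Properties using (fromℕ-toℕ)
open import Data.Product using (Σ; ∃; ∃₂; _×_; _,_; proj₁)
open import Data.Product.Function.Dependent.Propositional using (congˡ)
open import Data.Product.Function.NonDependent.Propositional using (_×-⇔_)
open import Data.Unit using (⊤; tt)
open import Data.Vec using (Vec; []; _∷_; map; lookup; tabulate; toList)
open import Data.Vec.Properties using (lookup-map; lookup∘tabulate; tabulate∘lookup; tabulate-cong)
open import Data.Vec.Relation.Unary.All using (All; []; _∷_)
open import Function using (_∘_)
open import Function.Bundles using (_⇔_; mk⇔; Equivalence)
open import Function.Construct.Composition using (_⇔-∘_)
open import Function.Construct.Identity using (⇔-id)
open import Function.Related.TypeIsomorphisms using (¬-cong-⇔)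
open import Level using (Level)
open import Relation.Nullary using (¬_; Dec; yes; no; ¬?; _×-dec_)
open import Relation.Nullary.Decidable as Dec using (isYes; toWitness; fromWitness; decidable-stable; T?)
open import Relation.Unary using (Pred; Decidable; _≐_)
open import Relation.Unary.Properties using (≐-refl; ≐-sym; ≐-trans)
open import Relation.Binary.PropositionalEquality
  using (_≡_; refl; sym; trans; cong; cong₂; subst; _≗_; module ≡-Reasoning)

open Equivalence using (to; from)

private
  variable
    ℓ : Level
    n k r N : ℕ

-- Congruence of the semantics

Interp : ℕ → Set
Interp n = (s : Sym) → Vec (Fin n) (arity s) → Bool

SymBelow : ℕ → Sym → Set
SymBelow N E       = ⊤
SymBelow N (R i j) = j < N

-- Variables bound by ex and lfp need no bound: the semantics overwrites them.
Within : ℕ → Formula → Set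
Within N (rel s ts)      = SymBelow N s × All (_< N) ts
Within N (eq x y)        = x < N × y < N
Within N (rv X ts)       = All (_< N) ts
Within N (neg φ)         = Within N φ
Within N (and φ ψ)       = Within N φ × Within N ψ
Within N (ex x φ)        = Within N φ
Within N (lfp P vs φ ts) = Within N φ × All (_< N) ts

symWidth : Sym → ℕ
symWidth E       = 0
symWidth (R i j) = suc j

varWidth : Vec ℕ k → ℕ
varWidth []       = 0
varWidth (x ∷ xs) = suc x ⊔ varWidth xs

width : Formula → ℕ
width (rel s ts)      = symWidth s ⊔ varWidth ts
width (eq x y)        = suc x ⊔ suc y
width (rv X ts)       = varWidth ts
width (neg φ)         = width φ
width (and φ ψ)       = width φ ⊔ width ψ
width (ex x φ)        = width φ
width (lfp P vs φ ts) = width φ ⊔ varWidth ts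

symWidth-below : ∀ s → symWidth s ≤ N → SymBelow N s
symWidth-below E       _   = tt
symWidth-below (R i j) j<N = j<N

varWidth-below : (xs : Vec ℕ k) → varWidth xs ≤ N → All (_< N) xs
varWidth-below []       _ = []
varWidth-below (x ∷ xs) w =
  m⊔n≤o⇒m≤o (suc x) (varWidth xs) w ∷ varWidth-below xs (m⊔n≤o⇒n≤o (suc x) (varWidth xs) w)

width-within : ∀ ψ → width ψ ≤ N → Within N ψ
width-within (rel s ts) w =
  symWidth-below s (m⊔n≤o⇒m≤o (symWidth s) _ w) , varWidth-below ts (m⊔n≤o⇒n≤o (symWidth s) _ w)
width-within (eq x y) w = m⊔n≤o⇒m≤o (suc x) (suc y) w , m⊔n≤o⇒n≤o (suc x) (suc y) w
width-within (rv X ts) w = varWidth-below ts w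
width-within (neg φ) w = width-within φ w
width-within (and φ ψ) w =
  width-within φ (m⊔n≤o⇒m≤o (width φ) _ w) , width-within ψ (m⊔n≤o⇒n≤o (width φ) _ w)
width-within (ex x φ) w = width-within φ w
width-within (lfp P vs φ ts) w =
  width-within φ (m⊔n≤o⇒m≤o (width φ) _ w) , varWidth-below ts (m⊔n≤o⇒n≤o (width φ) _ w)

AgreeBelow : ℕ → Assign n → Assign n → Set
AgreeBelow N ρ ρ′ = ∀ y → y < N → ρ y ≡ ρ′ y

InterpAgree : ℕ → Interp n → Interp n → Set
InterpAgree N I I′ = ∀ s → SymBelow N s → I s ≗ I′ s

EnvEquiv : REnv n → REnv n → Set
EnvEquiv η η′ = ∀ X k → η X k ≐ η′ X k

≐⇒⇔ : {A : Set} {P Q : Pred A ℓ} → P ≐ Q → ∀ a → P a ⇔ Q a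
≐⇒⇔ (P⊆Q , Q⊆P) a = mk⇔ P⊆Q Q⊆P

⇔⇒≐ : {A : Set} {P Q : Pred A ℓ} → (∀ a → P a ⇔ Q a) → P ≐ Q
⇔⇒≐ P⇔Q = (λ {a} → to (P⇔Q a)) , (λ {a} → from (P⇔Q a))

≡⇒⇔ : {A B : Set} → A ≡ B → A ⇔ B
≡⇒⇔ refl = ⇔-id _

[↦]-agree : ∀ {ρ ρ′ : Assign n} x a → AgreeBelow N ρ ρ′ →
            AgreeBelow N (ρ [ x ↦ a ]) (ρ′ [ x ↦ a ])
[↦]-agree x a ρ≈ y y<N with y ≟ x
... | yes _ = refl
... | no  _ = ρ≈ y y<N

updates-agree : ∀ {ρ ρ′ : Assign n} (vs : Vec ℕ r) as → AgreeBelow N ρ ρ′ →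
                AgreeBelow N (updates ρ vs as) (updates ρ′ vs as)
updates-agree []       []       ρ≈ = ρ≈
updates-agree (v ∷ vs) (a ∷ as) ρ≈ = updates-agree vs as ([↦]-agree v a ρ≈)

map-agree : ∀ {ρ ρ′ : Assign n} {ts : Vec ℕ k} → All (_< N) ts → AgreeBelow N ρ ρ′ →
            map ρ ts ≡ map ρ′ ts
map-agree []         ρ≈ = refl
map-agree (t<N ∷ ts) ρ≈ = cong₂ _∷_ (ρ≈ _ t<N) (map-agree ts ρ≈)

updRel-cong : ∀ {η η′ : REnv n} P r {S S′ : Pred (Vec (Fin n) r) _} →
              EnvEquiv η η′ → S ≐ S′ → EnvEquiv (updRel η P r S) (updRel η′ P r S′)
updRel-cong P r η≐ S≐ X k with X ≟ P | k ≟ r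
... | yes refl | yes refl = S≐
... | yes refl | no  _    = η≐ X k
... | no  _    | _        = η≐ X k

mutual
  ⟦⟧-cong : ∀ {M : Structure} {I : Interp (size M)} ψ →
            Within N ψ → InterpAgree N (interp M) I →
            ∀ {η η′} → EnvEquiv η η′ → ∀ {ρ ρ′} → AgreeBelow N ρ ρ′ →
            ⟦ ψ ⟧ M η ρ ⇔ ⟦ ψ ⟧ (record M { interp = I }) η′ ρ′
  ⟦⟧-cong {M = M} (rel s ts) (s<N , ts<N) I≈ η≐ ρ≈ =
    ≡⇒⇔ (cong T (trans (cong (interp M s) (map-agree ts<N ρ≈)) (I≈ s s<N _)))
  ⟦⟧-cong (eq x y) (x<N , y<N) I≈ η≐ ρ≈ rewrite ρ≈ x x<N | ρ≈ y y<N = ⇔-id _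
  ⟦⟧-cong (rv X {k} ts) ts<N I≈ η≐ ρ≈ rewrite map-agree ts<N ρ≈ = ≐⇒⇔ (η≐ X k) _
  ⟦⟧-cong (neg φ) w I≈ η≐ ρ≈ = ¬-cong-⇔ (⟦⟧-cong φ w I≈ η≐ ρ≈)
  ⟦⟧-cong (and φ ψ) (wφ , wψ) I≈ η≐ ρ≈ = ⟦⟧-cong φ wφ I≈ η≐ ρ≈ ×-⇔ ⟦⟧-cong ψ wψ I≈ η≐ ρ≈
  ⟦⟧-cong (ex x φ) w I≈ η≐ ρ≈ = congˡ λ {a} → ⟦⟧-cong φ w I≈ η≐ ([↦]-agree x a ρ≈)
  ⟦⟧-cong (lfp P vs φ ts) (w , ts<N) I≈ η≐ ρ≈ rewrite map-agree ts<N ρ≈ =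
    congˡ λ {i} → ≐⇒⇔ (stage-cong P vs φ w I≈ η≐ ρ≈ i) _

  stage-cong : ∀ {M : Structure} {I : Interp (size M)} P (vs : Vec ℕ r) φ →
               Within N φ → InterpAgree N (interp M) I →
               ∀ {η η′} → EnvEquiv η η′ → ∀ {ρ ρ′} → AgreeBelow N ρ ρ′ →
               ∀ i → stage P vs φ M η ρ i ≐ stage P vs φ (record M { interp = I }) η′ ρ′ i
  stage-cong P vs φ w I≈ η≐ ρ≈ zero    = (λ ()) , (λ ())
  stage-cong {r = r} P vs φ w I≈ η≐ ρ≈ (suc i) =
    ⇔⇒≐ λ a → ⟦⟧-cong φ w I≈ (updRel-cong P r η≐ (stage-cong P vs φ w I≈ η≐ ρ≈ i))
                                (updates-agree vs a ρ≈)

⟦⟧-cong-env : ∀ {M : Structure} ψ {η η′} → EnvEquiv η η′ → ∀ ρ → ⟦ ψ ⟧ M η ρ ⇔ ⟦ ψ ⟧ M η′ ρ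
⟦⟧-cong-env ψ η≐ ρ = ⟦⟧-cong ψ (width-within ψ ≤-refl) (λ _ _ _ → refl) η≐ (λ _ _ → refl)

stage-step : ∀ {M : Structure} P (vs : Vec ℕ r) φ {η} ρ {i j} →
             stage P vs φ M η ρ i ≐ stage P vs φ M η ρ j →
             stage P vs φ M η ρ (suc i) ≐ stage P vs φ M η ρ (suc j)
stage-step P vs φ ρ Sᵢ≐Sⱼ =
  ⇔⇒≐ λ a → ⟦⟧-cong-env φ (updRel-cong P _ (λ _ _ → ≐-refl) Sᵢ≐Sⱼ) (updates ρ vs a)

-- Decidability on finite structures

bit : {A : Set ℓ} → Dec A → Fin 2
bit (yes _) = suc zero
bit (no  _) = zero

bit-≡⇒ : {A B : Set ℓ} (A? : Dec A) (B? : Dec B) → bit A? ≡ bit B? → A → B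
bit-≡⇒ (yes _) (yes b) _  _ = b
bit-≡⇒ (yes _) (no  _) () _
bit-≡⇒ (no ¬a) _       _  a = ⊥-elim (¬a a)

funToFin-injective : ∀ {m} (f g : Fin n → Fin m) → funToFin f ≡ funToFin g → f ≗ g
funToFin-injective f g f≡g x = begin
  f x                       ≡⟨ sym (finToFun-funToFin f x) ⟩
  finToFun (funToFin f) x   ≡⟨ cong (λ c → finToFun c x) f≡g ⟩
  finToFun (funToFin g) x   ≡⟨ finToFun-funToFin g x ⟩
  g x                       ∎
  where open ≡-Reasoning

tabulate-finToFun-funToFin : ∀ (a : Vec (Fin n) r) → tabulate (finToFun (funToFin (lookup a))) ≡ a
tabulate-finToFun-funToFin a = trans (tabulate-cong (finToFun-funToFin (lookup a))) (tabulate∘lookup a)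


-- The characteristic function of P, indexed through Fin (n ^ r) ≅ Vec (Fin n) r.
relationCode : {P : Pred (Vec (Fin n) r) ℓ} → Decidable P → Fin (2 ^ (n ^ r))
relationCode {n = n} {r = r} P? = funToFin (λ c → bit (P? (tabulate (finToFun {n} {r} c))))

relationCode-⊆ : {P Q : Pred (Vec (Fin n) r) ℓ} (P? : Decidable P) (Q? : Decidable Q) →
                 relationCode P? ≡ relationCode Q? → ∀ a → P a → Q a
relationCode-⊆ {P = P} {Q} P? Q? P≡Q a =
  subst (λ b → P b → Q b) (tabulate-finToFun-funToFin a)
        (bit-≡⇒ (P? _) (Q? _) (funToFin-injective _ _ P≡Q (funToFin (lookup a))))

relationCode-injective : {P Q : Pred (Vec (Fin n) r) ℓ} (P? : Decidable P) (Q? : Decidable Q) →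
                         relationCode P? ≡ relationCode Q? → P ≐ Q
relationCode-injective P? Q? P≡Q =
  (λ {a} → relationCode-⊆ P? Q? P≡Q a) , (λ {a} → relationCode-⊆ Q? P? (sym P≡Q) a)

module _ (S : ℕ → Pred (Vec (Fin n) r) ℓ) (S? : ∀ i → Decidable (S i)) where

  repeats : ∃₂ λ p q → p < q × S p ≐ S q
  repeats
    with i , j , i<j , Sᵢ≡Sⱼ ← pigeonhole (≤-refl {suc (2 ^ (n ^ r))}) (λ i → relationCode (S? (toℕ i)))
    = toℕ i , toℕ j , i<j , relationCode-injective (S? _) (S? _) Sᵢ≡Sⱼ

  module _ (step : ∀ {i j} → S i ≐ S j → S (suc i) ≐ S (suc j)) where

    recurs-below : ∀ {p q} → p < q → S p ≐ S q → ∀ i → ∃ λ i′ → i′ < q × S i ≐ S i′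
    recurs-below p<q Sp≐Sq zero = 0 , ≤-<-trans z≤n p<q , ≐-refl
    recurs-below {p} {q} p<q Sp≐Sq (suc i) with recurs-below p<q Sp≐Sq i
    ... | i′ , i′<q , Si≐Si′ with suc i′ ≟ q
    ...   | yes refl    = p , p<q , ≐-trans (step Si≐Si′) (≐-sym Sp≐Sq)
    ...   | no  1+i′≢q = suc i′ , ≤∧≢⇒< i′<q 1+i′≢q , step Si≐Si′

    ⋃? : Decidable (λ a → ∃ λ i → S i a)
    ⋃? a with p , q , p<q , Sp≐Sq ← repeats =
      Dec.map (mk⇔ (λ (i , s) → toℕ i , s) below) (any? λ (i : Fin q) → S? (toℕ i) a)
      where
      below : ∃ (λ i → S i a) → ∃ λ (i : Fin q) → S (toℕ i) a
      below (i , s) with i′ , i′<q , Si≐Si′ ← recurs-below p<q Sp≐Sq i =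
        fromℕ< i′<q , subst (λ j → S j a) (sym (toℕ-fromℕ< i′<q)) (proj₁ Si≐Si′ s)

DecEnv : REnv n → Set
DecEnv η = ∀ X k → Decidable (η X k)

emptyEnv? : DecEnv {n} emptyEnv
emptyEnv? X k a = no λ ()

updRel? : ∀ {η : REnv n} P r {S : Pred (Vec (Fin n) r) _} → DecEnv η → Decidable S →
          DecEnv (updRel η P r S)
updRel? P r η? S? X k with X ≟ P | k ≟ r
... | yes refl | yes refl = S?
... | yes refl | no  _    = η? X k
... | no  _    | _        = η? X k

mutual
  ⟦_⟧? : ∀ ψ (M : Structure) {η} → DecEnv η → ∀ ρ → Dec (⟦ ψ ⟧ M η ρ)
  ⟦ rel s ts ⟧?      M η? ρ = T? _
  ⟦ eq x y ⟧?        M η? ρ = ρ x ≟ᶠ ρ y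
  ⟦ rv X ts ⟧?       M η? ρ = η? X _ (map ρ ts)
  ⟦ neg φ ⟧?         M η? ρ = ¬? (⟦ φ ⟧? M η? ρ)
  ⟦ and φ ψ ⟧?       M η? ρ = ⟦ φ ⟧? M η? ρ ×-dec ⟦ ψ ⟧? M η? ρ
  ⟦ ex x φ ⟧?        M η? ρ = any? λ a → ⟦ φ ⟧? M η? (ρ [ x ↦ a ])
  ⟦ lfp P vs φ ts ⟧? M η? ρ =
    ⋃? _ (stage? P vs φ M η? ρ) (λ {i j} → stage-step P vs φ ρ {i} {j}) (map ρ ts)

  stage? : ∀ P (vs : Vec ℕ r) φ (M : Structure) {η} → DecEnv η →
           ∀ ρ i → Decidable (stage P vs φ M η ρ i)
  stage? P vs φ M η? ρ zero    a = no λ ()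
  stage? P vs φ M η? ρ (suc i) a = ⟦ φ ⟧? M (updRel? P _ η? (stage? P vs φ M η? ρ i)) (updates ρ vs a)

-- Gödel numbering

tokens : Formula → List ℕ
tokens (rel E ts)            = 0 ∷ toList ts
tokens (rel (R i j) ts)      = 1 ∷ i ∷ j ∷ toList ts
tokens (eq x y)              = 2 ∷ x ∷ y ∷ []
tokens (rv X {k} ts)         = 3 ∷ X ∷ k ∷ toList ts
tokens (neg φ)               = 4 ∷ tokens φ
tokens (and φ ψ)             = 5 ∷ tokens φ ++ tokens ψ
tokens (ex x φ)              = 6 ∷ x ∷ tokens φ
tokens (lfp P {r} vs φ ts)   = 7 ∷ P ∷ r ∷ toList vs ++ toList ts ++ tokens φ

depth : Formula → ℕ
depth (rel s ts)      = 1
depth (eq x y)        = 1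
depth (rv X ts)       = 1
depth (neg φ)         = suc (depth φ)
depth (and φ ψ)       = suc (depth φ ⊔ depth ψ)
depth (ex x φ)        = suc (depth φ)
depth (lfp P vs φ ts) = suc (depth φ)

parseVec : ∀ k → List ℕ → Maybe (Vec ℕ k × List ℕ)
parseVec zero    l       = just ([] , l)
parseVec (suc k) []      = nothing
parseVec (suc k) (x ∷ l) = parseVec k l >>= λ (xs , l′) → just (x ∷ xs , l′)

parse : ℕ → List ℕ → Maybe (Formula × List ℕ)
parse zero    _                 = nothing
parse (suc f) (0 ∷ l)           = parseVec 2 l >>= λ (ts , l′) → just (rel E ts , l′)
parse (suc f) (1 ∷ i ∷ j ∷ l)   = parseVec (suc j) l >>= λ (ts , l′) → just (rel (R i j) ts , l′)
parse (suc f) (2 ∷ x ∷ y ∷ l)   = just (eq x y , l)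
parse (suc f) (3 ∷ X ∷ k ∷ l)   = parseVec k l >>= λ (ts , l′) → just (rv X ts , l′)
parse (suc f) (4 ∷ l)           = parse f l >>= λ (φ , l′) → just (neg φ , l′)
parse (suc f) (5 ∷ l)           =
  parse f l >>= λ (φ , l₁) → parse f l₁ >>= λ (ψ , l₂) → just (and φ ψ , l₂)
parse (suc f) (6 ∷ x ∷ l)       = parse f l >>= λ (φ , l′) → just (ex x φ , l′)
parse (suc f) (7 ∷ P ∷ r ∷ l)   =
  parseVec r l  >>= λ (vs , l₁) →
  parseVec r l₁ >>= λ (ts , l₂) →
  parse f l₂    >>= λ (φ , l₃) → just (lfp P vs φ ts , l₃)
parse (suc f) _                 = nothing

parseVec-toList : ∀ (xs : Vec ℕ k) l → parseVec k (toList xs ++ l) ≡ just (xs , l)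
parseVec-toList []       l = refl
parseVec-toList (x ∷ xs) l rewrite parseVec-toList xs l = refl

parse-tokens : ∀ ψ {f} l → depth ψ ≤ f → parse f (tokens ψ ++ l) ≡ just (ψ , l)
parse-tokens (rel E ts)       l (s≤s _) rewrite parseVec-toList ts l = refl
parse-tokens (rel (R i j) ts) l (s≤s _) rewrite parseVec-toList ts l = refl
parse-tokens (eq x y)         l (s≤s _) = refl
parse-tokens (rv X ts)        l (s≤s _) rewrite parseVec-toList ts l = refl
parse-tokens (neg φ)          l (s≤s d) rewrite parse-tokens φ l d = refl
parse-tokens (and φ ψ)        l (s≤s d)
  rewrite ++-assoc (tokens φ) (tokens ψ) l
        | parse-tokens φ (tokens ψ ++ l) (m⊔n≤o⇒m≤o (depth φ) (depth ψ) d)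
        | parse-tokens ψ l (m⊔n≤o⇒n≤o (depth φ) (depth ψ) d) = refl
parse-tokens (ex x φ)         l (s≤s d) rewrite parse-tokens φ l d = refl
parse-tokens (lfp P vs φ ts)  l (s≤s d)
  rewrite ++-assoc (toList vs) (toList ts ++ tokens φ) l
        | ++-assoc (toList ts) (tokens φ) l
        | parseVec-toList vs (toList ts ++ tokens φ ++ l)
        | parseVec-toList ts (tokens φ ++ l)
        | parse-tokens φ l d = refl

unary : ℕ → ℕᵇ → ℕᵇ
unary zero    b = b
unary (suc x) b = 1+[2 unary x b ]

-- x₁ ∷ ⋯ ∷ xₖ becomes the binary digit string 1^x₁ 2 ⋯ 1^xₖ 2 (least significant digit first).
pack : List ℕ → ℕᵇ
pack []       = ℕᵇ.zero
pack (x ∷ xs) = unary x 2[1+ pack xs ]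

incrementHead : List ℕ → List ℕ
incrementHead []       = []
incrementHead (x ∷ xs) = suc x ∷ xs

unpack : ℕᵇ → List ℕ
unpack ℕᵇ.zero  = []
unpack 2[1+ b ] = 0 ∷ unpack b
unpack 1+[2 b ] = incrementHead (unpack b)

unpack-unary : ∀ x b → unpack (unary x 2[1+ b ]) ≡ x ∷ unpack b
unpack-unary zero    b = refl
unpack-unary (suc x) b = cong incrementHead (unpack-unary x b)

unpack-pack : ∀ xs → unpack (pack xs) ≡ xs
unpack-pack []       = refl
unpack-pack (x ∷ xs) = trans (unpack-unary x (pack xs)) (cong (x ∷_) (unpack-pack xs))

-- The depth is stored as a first token: it is the fuel parse needs.
⌜_⌝ : Formula → ℕ
⌜ ψ ⌝ = ℕᵇ.toℕ (pack (depth ψ ∷ tokens ψ))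

parseWithFuel : List ℕ → Maybe Formula
parseWithFuel []      = nothing
parseWithFuel (f ∷ l) = Maybe.map proj₁ (parse f l)

decode : ℕ → Maybe Formula
decode c = parseWithFuel (unpack (ℕᵇ.fromℕ c))

decode-⌜⌝ : ∀ ψ → decode ⌜ ψ ⌝ ≡ just ψ
decode-⌜⌝ ψ = begin
  parseWithFuel (unpack (ℕᵇ.fromℕ (ℕᵇ.toℕ (pack ts))))
    ≡⟨ cong (parseWithFuel ∘ unpack) (fromℕ-toℕ (pack ts)) ⟩
  parseWithFuel (unpack (pack ts))
    ≡⟨ cong parseWithFuel (unpack-pack ts) ⟩
  Maybe.map proj₁ (parse (depth ψ) (tokens ψ))
    ≡⟨ cong (Maybe.map proj₁ ∘ parse (depth ψ)) (sym (++-identityʳ (tokens ψ))) ⟩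
  Maybe.map proj₁ (parse (depth ψ) (tokens ψ ++ []))
    ≡⟨ cong (Maybe.map proj₁) (parse-tokens ψ [] ≤-refl) ⟩
  just ψ ∎
  where
  open ≡-Reasoning
  ts : List ℕ
  ts = depth ψ ∷ tokens ψ

-- The structures

successor : Vec (Fin n) 2 → Bool
successor (x ∷ y ∷ []) = isYes (toℕ y ≟ suc (toℕ x))

RInterp : ℕ → Set
RInterp n = (i j : ℕ) → Vec (Fin n) (suc j) → Bool

pathInterp : RInterp n → Interp n
pathInterp I E       = successor
pathInterp I (R i j) = I i j

path : ∀ m → RInterp (suc m) → Structure
path m I = record { size = suc m ; interp = pathInterp I }

tupleAssign : ∀ {m} → Vec (Fin (suc m)) k → Assign (suc m)
tupleAssign {k = k} a y with y <? k
... | yes y<k = lookup a (fromℕ< y<k)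
... | no  _   = zero

firstVars : ∀ k → Vec ℕ k
firstVars k = tabulate toℕ

tupleAssign-firstVars : ∀ {m} (ρ : Assign (suc m)) →
                        AgreeBelow k (tupleAssign (map ρ (firstVars k))) ρ
tupleAssign-firstVars {k = k} ρ y y<k with y <? k
... | yes y<k′ = begin
  lookup (map ρ (tabulate toℕ)) (fromℕ< y<k′) ≡⟨ lookup-map (fromℕ< y<k′) ρ (tabulate toℕ) ⟩
  ρ (lookup (tabulate toℕ) (fromℕ< y<k′))     ≡⟨ cong ρ (lookup∘tabulate toℕ (fromℕ< y<k′)) ⟩
  ρ (toℕ (fromℕ< y<k′))                        ≡⟨ cong ρ (toℕ-fromℕ< y<k′) ⟩
  ρ y                                           ∎
  where open ≡-Reasoning
... | no y≮k = ⊥-elim (y≮k y<k)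

codedRelation : ∀ m → RInterp (suc m) → ℕ → Vec (Fin (suc m)) k → Bool
codedRelation m I c a =
  maybe (λ ψ → isYes (⟦ ψ ⟧? (path m I) emptyEnv? (tupleAssign a))) false (decode c)

approx : ∀ m → ℕ → RInterp (suc m)
approx m zero    i j a = false
approx m (suc k) i j a with j ≟ k
... | yes refl = codedRelation m (approx m k) i a
... | no  _    = approx m k i j a

approx-correct : ∀ {m i j} k (a : Vec (Fin (suc m)) (suc j)) → j < k →
                 approx m k i j a ≡ codedRelation m (approx m j) i a
approx-correct {j = j} (suc k) a (s≤s j≤k) with j ≟ k
... | yes refl = refl
... | no  j≢k  = approx-correct k a (≤∧≢⇒< j≤k j≢k)

D : ℕ → Structure
D m = path m λ i j → codedRelation m (approx m j) i

codedRelation-⌜⌝ : ∀ m I ψ (a : Vec (Fin (suc m)) k) →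
                   ⟦ ψ ⟧ (path m I) emptyEnv (tupleAssign a) ⇔ T (codedRelation m I ⌜ ψ ⌝ a)
codedRelation-⌜⌝ m I ψ a rewrite decode-⌜⌝ ψ = mk⇔ fromWitness toWitness

collapse : ∀ ψ → EquivOn D ψ (rel (R ⌜ ψ ⌝ (width ψ)) (firstVars (suc (width ψ))))
collapse ψ m ρ =
  codedRelation-⌜⌝ m (approx m J) ψ a ⇔-∘
  ⟦⟧-cong ψ (width-within ψ ≤-refl) approx-agrees (λ _ _ → ≐-refl) tuple-agrees
  where
  J : ℕ
  J = width ψ
  a : Vec (Fin (suc m)) (suc J)
  a = map ρ (firstVars (suc J))
  approx-agrees : InterpAgree J (interp (D m)) (pathInterp (approx m J))
  approx-agrees E       _   _ = refl
  approx-agrees (R i j) j<J b = sym (approx-correct J b j<J)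
  tuple-agrees : AgreeBelow J ρ (tupleAssign a)
  tuple-agrees y y<J = sym (tupleAssign-firstVars ρ y (m<n⇒m<1+n y<J))

-- Unbounded depth

-- E(x, y) ∨ ∃z (E(x, z) ∧ P(z, y)), with x, y, z the variables 0, 1, 2 and P the
-- binary relation variable 0.
reach : Formula
reach = neg (and (neg (rel E (0 ∷ 1 ∷ []))) (neg (ex 2 (and (rel E (0 ∷ 2 ∷ [])) (rv 0 (2 ∷ 1 ∷ []))))))

SuccessorEdges : Structure → Set
SuccessorEdges M = ∀ x y → T (interp M E (x ∷ y ∷ [])) ⇔ (toℕ y ≡ suc (toℕ x))

module _ (M : Structure) (ρ : Assign (size M)) where

  Reach : ℕ → Fin (size M) → Fin (size M) → Set
  Reach k x y = stage 0 (0 ∷ 1 ∷ []) reach M emptyEnv ρ k (x ∷ y ∷ [])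

module _ {M : Structure} (succ : SuccessorEdges M) (ρ : Assign (size M)) where

  reach-upper : ∀ k x y → Reach M ρ k x y → toℕ y ≤ toℕ x + k
  reach-upper (suc k) x y r =
    decidable-stable (toℕ y ≤? toℕ x + suc k) λ y≰ → r (y≰ ∘ edge-bound , y≰ ∘ step-bound)
    where
    open ≤-Reasoning
    edge-bound : T (interp M E (x ∷ y ∷ [])) → toℕ y ≤ toℕ x + suc k
    edge-bound e = begin
      toℕ y             ≡⟨ to (succ x y) e ⟩
      suc (toℕ x)       ≤⟨ s≤s (m≤m+n (toℕ x) k) ⟩
      suc (toℕ x + k)   ≡⟨ +-suc (toℕ x) k ⟨
      toℕ x + suc k     ∎
    step-bound : (∃ λ z → T (interp M E (x ∷ z ∷ [])) × Reach M ρ k z y) → toℕ y ≤ toℕ x + suc k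
    step-bound (z , e , r) = begin
      toℕ y             ≤⟨ reach-upper k z y r ⟩
      toℕ z + k         ≡⟨ cong (_+ k) (to (succ x z) e) ⟩
      suc (toℕ x + k)   ≡⟨ +-suc (toℕ x) k ⟨
      toℕ x + suc k     ∎

  reach-lower : ∀ k x y → toℕ y ≡ toℕ x + suc k → Reach M ρ (suc k) x y
  reach-lower zero x y y≡x+1 (¬edge , _) =
    ¬edge (from (succ x y) (trans y≡x+1 (+-comm (toℕ x) 1)))
  reach-lower (suc k) x y y≡x+2+k (_ , ¬step) =
    ¬step (z , from (succ x z) z≡x+1 , reach-lower k z y y≡z+1+k)
    where
    x+1<y : suc (toℕ x) < toℕ y
    x+1<y = begin-strict
      suc (toℕ x)           <⟨ s≤s (s≤s (m≤m+n (toℕ x) k)) ⟩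
      suc (suc (toℕ x + k)) ≡⟨ trans (+-suc (toℕ x) (suc k)) (cong suc (+-suc (toℕ x) k)) ⟨
      toℕ x + suc (suc k)   ≡⟨ y≡x+2+k ⟨
      toℕ y                 ∎
      where open ≤-Reasoning
    z : Fin (size M)
    z = fromℕ< (<-trans x+1<y (toℕ<n y))
    z≡x+1 : toℕ z ≡ suc (toℕ x)
    z≡x+1 = toℕ-fromℕ< _
    y≡z+1+k : toℕ y ≡ toℕ z + suc k
    y≡z+1+k = trans y≡x+2+k (trans (+-suc (toℕ x) (suc k)) (cong (_+ suc k) (sym z≡x+1)))

D-successor : ∀ m → SuccessorEdges (D m)
D-successor m x y = mk⇔ toWitness fromWitness

reach-unbounded : ∀ j → ¬ (∀ m (ρ : Assign (suc m)) (a : Vec (Fin (suc m)) 2) →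
                           stage 0 (0 ∷ 1 ∷ []) reach (D m) emptyEnv ρ j a ⇔
                           ∃ λ i → stage 0 (0 ∷ 1 ∷ []) reach (D m) emptyEnv ρ i a)
reach-unbounded j stable =
  1+n≰n (subst (_≤ j) (toℕ-fromℕ (suc j)) (reach-upper succ ρ j zero y reached))
  where
  succ : SuccessorEdges (D (suc j))
  succ = D-successor (suc j)
  ρ : Assign (suc (suc j))
  ρ _ = zero
  y : Fin (suc (suc j))
  y = fromℕ (suc j)
  reached : Reach (D (suc j)) ρ j zero y
  reached =
    from (stable (suc j) ρ (zero ∷ y ∷ [])) (suc j , reach-lower succ ρ j zero y (toℕ-fromℕ (suc j)))

distinct01 : Distinct (0 ∷ 1 ∷ [])
distinct01 zero       zero       _ = refl
distinct01 zero       (suc zero) ()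
distinct01 (suc zero) zero       ()
distinct01 (suc zero) (suc zero) _ = refl

unbounded-depth : UnboundedDepth D
unbounded-depth =
  0 , 2 , (0 ∷ 1 ∷ []) , reach , (((tt , tt , tt) , (tt , tt , here refl)) , (tt , tt , tt) , distinct01) ,
  λ (j , stable) → reach-unbounded j stable

lemma3p2 : Σ (ℕ → Structure) λ D →
    UnboundedDepth D ×
    (∀ (ψ : Formula) → IsFOLFP ψ → Σ Formula λ χ → IsFO χ × EquivOn D ψ χ)
lemma3p2 = D , unbounded-depth , λ ψ _ →
  rel (R ⌜ ψ ⌝ (width ψ)) (firstVars (suc (width ψ))) , (tt , tt) , collapse ψ
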